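{- Let $n\geq 1$. Let $b_1(n)$ be the total number of parts in all partitions of $n$ into distinct parts minus the total number of different parts in all partitions of $n$ into odd parts, where in each partition into odd parts every distinct part value is counted once. Let $\overline{\mathcal D}(n)$ be the set of pairs $(\mu,p)$ such that: - $\mu$ is a partition of $n$ into distinct parts; - $p=2^s m$ is a part of $\mu$ with $s\ge 1$ and $m$ odd; - $\mu$ also has a part $2^t m$ for some $0\le t<s$. (Equivalently, $\overline{\mathcal D}(n)$ is the set of overpartitions of $n$ into distinct parts with exactly one overlined part $p$, where a part $2^sm$ may be overlined only if some part $2^tm$ with $t<s$ is present.) Then $b_1(n)=|\overline{\mathcal D}(n)|$.
   Context: A partition of $n$ is a non-increasing sequence of positive integers (its parts) summing to $n$. -}

module Defs where

open import Data.Nat using (ℕ; zero; suc; _+_; _*_; _^_; _≤_; _<_; _≥_; _≟_)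
open import Data.List using (List; []; _∷_; length; deduplicate; map)
open import Data.Nat.ListAction using (sum)
open import Data.List.Membership.Propositional using (_∈_)
open import Data.List.Relation.Unary.All using (All)
open import Data.List.Relation.Unary.Linked using (Linked)
open import Data.List.Relation.Unary.Unique.Propositional using (Unique)
open import Data.Product using (_×_; Σ; ∃; ∃-syntax)
open import Relation.Binary.PropositionalEquality using (_≡_)

IsPartition : ℕ → List ℕ → Set
IsPartition n μ = All (λ x → 1 ≤ x) μ × Linked _≥_ μ × sum μ ≡ n

IsDistinctPartition : ℕ → List ℕ → Set
IsDistinctPartition n μ = IsPartition n μ × Unique μ

Odd : ℕ → Set
Odd m = ∃[ k ] m ≡ suc (2 * k)

IsOddPartition : ℕ → List ℕ → Set
IsOddPartition n μ = IsPartition n μ × All Odd μ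

numDifferentParts : List ℕ → ℕ
numDifferentParts μ = length (deduplicate _≟_ μ)

InDbar : ℕ → List ℕ × ℕ → Set
InDbar n (μ Data.Product., p) =
  IsDistinctPartition n μ × p ∈ μ ×
  (∃[ s ] ∃[ m ] ∃[ t ] (1 ≤ s × Odd m × p ≡ 2 ^ s * m × t < s × 2 ^ t * m ∈ μ))

Enumerates : {A : Set} → (A → Set) → List A → Set
Enumerates {A} P L = Unique L × (∀ (x : A) → (x ∈ L → P x) × (P x → x ∈ L))

-- Glaisher's map sends a partition μ into distinct parts to the partition into odd parts
-- obtained by splitting each part 2^s m (m odd) into 2^s copies of m. It is injective
-- because, for each odd m, the multiplicity of m in the image is the binary number
-- Σ 2^s over the parts 2^s m of μ, and it is onto because an odd partition is recovered
-- by repeatedly merging two equal parts. The different parts of the image are the odd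
-- parts of the parts of μ, one for each class {2^s m ∈ μ}; all parts of a class except
-- its smallest one are exactly the parts that may be overlined. Hence
-- #parts(μ) = #different parts(Glaisher μ) + #overlinable parts(μ), and summing over μ
-- gives the theorem.

module Submission where

open import Defs
open import Data.Nat using (ℕ; zero; suc; _+_; _*_; _^_; _≤_; _<_; _≥_; z≤n; s≤s; _≟_; _<?_)
open import Data.Nat.Properties
  using ( suc-injective; ≤-refl; ≤-trans; ≤-pred; <-cmp; ≰⇒>; <⇒≱; ≤-decTotalOrder
        ; +-identityʳ; +-suc; m≤m+n; m<m+n; m+n∸m≡n; +-commutativeSemigroup
        ; *-identityˡ; *-suc; *-assoc; *-distribˡ-+; *-cancelˡ-≡; m≤n*m
        ; *-mono-≤; *-monoˡ-≤; *-monoˡ-<; m^n>0; ^-monoʳ-≤; ^-monoʳ-<; even≢odd )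
open import Data.Nat.Induction using (<-rec)
open import Data.Nat.ListAction using (sum)
open import Data.Nat.ListAction.Properties using (sum-++; sum-↭)
open import Data.Integer using (+_; _-_)
open import Data.Integer.Properties using ([+m]-[+n]≡m⊖n; ⊖-≥)
open import Data.List using (List; []; _∷_; [_]; _++_; length; map; filter; replicate; concatMap; deduplicate)
open import Data.List.Properties
  using ( ++-assoc; length-++; length-map; length-replicate; map-∘; map-cong; map-cong-local
        ; filter-++; filter-all; filter-none; filter-accept; filter-reject )
open import Data.List.Membership.Propositional using (_∈_; _∉_; find; lose)
open import Data.List.Membership.Propositional.Properties
  using ( ∈-map⁺; ∈-map⁻; ∈-filter⁺; ∈-filter⁻; ∈-concatMap⁺; ∈-concatMap⁻
        ; ∈-deduplicate⁺; ∈-deduplicate⁻ )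
open import Data.List.Membership.Propositional.Properties.WithK using (unique∧set⇒bag)
open import Data.List.Membership.DecPropositional _≟_ using (_∈?_)
open import Data.List.Relation.Unary.Any using (Any; here; there; any?; _─_)
open import Data.List.Relation.Unary.All as All using (All; []; _∷_)
import Data.List.Relation.Unary.All.Properties as All
import Data.List.Relation.Unary.AllPairs as AllPairs
import Data.List.Relation.Unary.AllPairs.Properties as AllPairs
open import Data.List.Relation.Unary.Linked using (Linked)
open import Data.List.Relation.Unary.Unique.Propositional using (Unique; []; _∷_)
import Data.List.Relation.Unary.Unique.Propositional.Properties as Unique
open import Data.List.Relation.Unary.Unique.DecPropositional.Properties _≟_ using (deduplicate-!)
open import Data.List.Relation.Unary.Sorted.TotalOrder.Properties using (↗↭↗⇒≋)
open import Data.List.Relation.Binary.Subset.Propositional using (_⊆_)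
open import Data.List.Relation.Binary.Pointwise using (Pointwise-≡⇒≡)
open import Data.List.Relation.Binary.Permutation.Propositional
  using (_↭_; ↭-refl; ↭-sym; ↭-trans; ↭-prep; ↭-swap; ↭-reflexive; ↭⇒↭ₛ; module PermutationReasoning)
open import Data.List.Relation.Binary.Permutation.Propositional.Properties
  using (↭-length; ++⁺ˡ; All-resp-↭; ∈-resp-↭; filter-↭; map⁺)
open import Relation.Binary.PropositionalEquality.Properties using (setoid)
import Data.List.Relation.Binary.Permutation.Setoid.Properties (setoid ℕ) as PermutationSetoid
import Data.List.Relation.Binary.BagAndSetEquality as Bag
open import Data.Product using (_×_; _,_; proj₁; proj₂; ∃-syntax)
open import Function using (_∘_)
open import Function.Bundles using (mk⇔)
open import Algebra.Properties.CommutativeSemigroup +-commutativeSemigroup using (interchange)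
open import Relation.Nullary using (Dec; yes; no; ¬_; ¬?; contradiction)
open import Relation.Nullary.Decidable using (_×-dec_)
open import Relation.Unary using (Decidable)
open import Relation.Binary using (DecTotalOrder; tri<; tri≈; tri>)
open import Relation.Binary.Properties.DecTotalOrder ≤-decTotalOrder using (≥-decTotalOrder)
open import Data.List.Sort ≥-decTotalOrder using (sort; sort-↭; sort-↗)
open import Relation.Binary.PropositionalEquality
  using (_≡_; _≢_; refl; sym; trans; cong; cong₂; subst; subst₂; module ≡-Reasoning)

sum-replicate : ∀ k m → sum (replicate k m) ≡ k * m
sum-replicate zero m = refl
sum-replicate (suc k) m = cong (_+_ m) (sum-replicate k m)

replicate-+ : ∀ {A : Set} k l (x : A) → replicate (k + l) x ≡ replicate k x ++ replicate l x
replicate-+ zero l x = refl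
replicate-+ (suc k) l x = cong (x ∷_) (replicate-+ k l x)

sum-map-+ : ∀ {A : Set} (f g : A → ℕ) xs → sum (map (λ x → f x + g x) xs) ≡ sum (map f xs) + sum (map g xs)
sum-map-+ f g [] = refl
sum-map-+ f g (x ∷ xs) = trans (cong (λ s → f x + g x + s) (sum-map-+ f g xs)) (interchange (f x) (g x) _ _)

length-filter-++ : ∀ {A : Set} {P : A → Set} (P? : Decidable P) xs {ys} →
                   length (filter P? (xs ++ ys)) ≡ length (filter P? xs) + length (filter P? ys)
length-filter-++ P? xs {ys} = trans (cong length (filter-++ P? xs ys)) (length-++ (filter P? xs))

length-filter-complement : ∀ {A : Set} {P : A → Set} (P? : Decidable P) xs →
                           length xs ≡ length (filter (¬? ∘ P?) xs) + length (filter P? xs)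
length-filter-complement P? [] = refl
length-filter-complement P? (x ∷ xs) with P? x
... | yes _ = trans (cong suc (length-filter-complement P? xs)) (sym (+-suc _ _))
... | no _ = cong suc (length-filter-complement P? xs)

─-↭ : ∀ {A : Set} {x : A} {xs} (x∈xs : x ∈ xs) → xs ↭ x ∷ (xs ─ x∈xs)
─-↭ (here refl) = ↭-refl
─-↭ {xs = y ∷ xs} (there x∈xs) = ↭-trans (↭-prep y (─-↭ x∈xs)) (↭-swap y _ ↭-refl)

Unique-resp-↭ : ∀ {xs ys : List ℕ} → xs ↭ ys → Unique xs → Unique ys
Unique-resp-↭ xs↭ys = PermutationSetoid.Unique-resp-↭ (↭⇒↭ₛ xs↭ys)

map⁺-injectiveOn : ∀ {A B : Set} {P : A → Set} {xs} (f : A → B) →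
                   (∀ {x y} → P x → P y → f x ≡ f y → x ≡ y) → All P xs → Unique xs → Unique (map f xs)
map⁺-injectiveOn f inj [] [] = []
map⁺-injectiveOn f inj (px ∷ pxs) (x∉xs ∷ u) =
  All.map⁺ (All.zipWith (λ (x≢y , py) fx≡fy → x≢y (inj px py fx≡fy)) (x∉xs , pxs))
  ∷ map⁺-injectiveOn f inj pxs u

enumerates⇒All : ∀ {A : Set} {P : A → Set} {xs} → Enumerates P xs → All P xs
enumerates⇒All (_ , isXs) = All.tabulate (proj₁ (isXs _))

unique-⊆⊇⇒↭ : ∀ {A : Set} {xs ys : List A} → Unique xs → Unique ys → xs ⊆ ys → ys ⊆ xs → xs ↭ ys
unique-⊆⊇⇒↭ uxs uys xs⊆ys ys⊆xs = Bag.∼bag⇒↭ (unique∧set⇒bag uxs uys (mk⇔ xs⊆ys ys⊆xs))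

unique⊆⊇⇒length-deduplicate : ∀ {xs ys} → Unique xs → xs ⊆ ys → ys ⊆ xs →
                              length (deduplicate _≟_ ys) ≡ length xs
unique⊆⊇⇒length-deduplicate {xs} {ys} uxs xs⊆ys ys⊆xs = ↭-length (unique-⊆⊇⇒↭ (deduplicate-! ys) uxs
  (ys⊆xs ∘ ∈-deduplicate⁻ _≟_ ys) (∈-deduplicate⁺ _≟_ ∘ xs⊆ys))

sorted-↭⇒≡ : ∀ {xs ys} → Linked _≥_ xs → Linked _≥_ ys → xs ↭ ys → xs ≡ ys
sorted-↭⇒≡ xs↘ ys↘ xs↭ys =
  Pointwise-≡⇒≡ (↗↭↗⇒≋ (DecTotalOrder.totalOrder ≥-decTotalOrder) xs↘ ys↘ (↭⇒↭ₛ xs↭ys))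

+[m+n]-+m≡+n : ∀ m n → + (m + n) - + m ≡ + n
+[m+n]-+m≡+n m n = trans ([+m]-[+n]≡m⊖n (m + n) m) (trans (⊖-≥ (m≤m+n m n)) (cong +_ (m+n∸m≡n m n)))

-- The 2-adic decomposition p = 2 ^ v₂ p * oddPart p

data Parity (n : ℕ) : Set where
  even : ∀ k → 2 * k ≡ n → Parity n
  odd  : Odd n → Parity n

parity : ∀ n → Parity n
parity zero = even 0 refl
parity (suc n) with parity n
... | even k refl = odd (k , refl)
... | odd (k , refl) = even (suc k) (*-suc 2 k)

2^[1+s]*m : ∀ s m → 2 ^ suc s * m ≡ 2 * (2 ^ s * m)
2^[1+s]*m s m = *-assoc 2 (2 ^ s) m

2^s*m-injective : ∀ s s′ {m m′} → Odd m → Odd m′ → 2 ^ s * m ≡ 2 ^ s′ * m′ → s ≡ s′ × m ≡ m′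
2^s*m-injective zero zero _ _ eq = refl , trans (sym (*-identityˡ _)) (trans eq (*-identityˡ _))
2^s*m-injective zero (suc s′) {m′ = m′} (k , refl) _ eq =
  contradiction (trans (sym (2^[1+s]*m s′ m′)) (trans (sym eq) (*-identityˡ _))) (even≢odd (2 ^ s′ * m′) k)
2^s*m-injective (suc s) zero {m} _ (k , refl) eq =
  contradiction (trans (sym (2^[1+s]*m s m)) (trans eq (*-identityˡ _))) (even≢odd (2 ^ s * m) k)
2^s*m-injective (suc s) (suc s′) {m} {m′} om om′ eq
  with refl , refl ← 2^s*m-injective s s′ om om′ (*-cancelˡ-≡ (2 ^ s * m) (2 ^ s′ * m′) 2
                       (trans (sym (2^[1+s]*m s m)) (trans eq (2^[1+s]*m s′ m′))))
  = refl , refl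

record TwoAdic (p : ℕ) : Set where
  field
    valuation oddFactor : ℕ
    oddFactor-odd : Odd oddFactor
    decomposition : 2 ^ valuation * oddFactor ≡ p

twoAdic : ∀ p → 1 ≤ p → TwoAdic p
twoAdic = <-rec (λ p → 1 ≤ p → TwoAdic p) step
  where
  step : ∀ p → (∀ {q} → q < p → 1 ≤ q → TwoAdic q) → 1 ≤ p → TwoAdic p
  step p rec 1≤p with parity p
  ... | odd o = record { valuation = 0 ; oddFactor = p ; oddFactor-odd = o ; decomposition = +-identityʳ p }
  ... | even zero refl = contradiction 1≤p λ ()
  ... | even k@(suc _) refl = record
    { valuation = suc valuation ; oddFactor = oddFactor ; oddFactor-odd = oddFactor-odd
    ; decomposition = trans (2^[1+s]*m valuation oddFactor) (cong (2 *_) decomposition) }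
    where open TwoAdic (rec (m<m+n k (m≤m+n 1 _)) (s≤s z≤n))

-- 0 has no 2-adic decomposition: v₂ 0 = oddPart 0 = 0 are junk values.
v₂ oddPart : ℕ → ℕ
v₂ zero = 0
v₂ p@(suc _) = TwoAdic.valuation (twoAdic p (s≤s z≤n))
oddPart zero = 0
oddPart p@(suc _) = TwoAdic.oddFactor (twoAdic p (s≤s z≤n))

2^v₂*oddPart : ∀ {p} → 1 ≤ p → 2 ^ v₂ p * oddPart p ≡ p
2^v₂*oddPart {p@(suc _)} _ = TwoAdic.decomposition (twoAdic p (s≤s z≤n))

oddPart-odd : ∀ {p} → 1 ≤ p → Odd (oddPart p)
oddPart-odd {p@(suc _)} _ = TwoAdic.oddFactor-odd (twoAdic p (s≤s z≤n))

odd⇒≥1 : ∀ {m} → Odd m → 1 ≤ m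
odd⇒≥1 (_ , refl) = s≤s z≤n

2^s*odd≥1 : ∀ s {m} → Odd m → 1 ≤ 2 ^ s * m
2^s*odd≥1 s om = *-mono-≤ (m^n>0 2 s) (odd⇒≥1 om)

v₂-oddPart-2^s*m : ∀ s {m} → Odd m → v₂ (2 ^ s * m) ≡ s × oddPart (2 ^ s * m) ≡ m
v₂-oddPart-2^s*m s om = 2^s*m-injective _ s (oddPart-odd p≥1) om (2^v₂*oddPart p≥1)
  where p≥1 = 2^s*odd≥1 s om

v₂-oddPart-odd : ∀ {m} → Odd m → v₂ m ≡ 0 × oddPart m ≡ m
v₂-oddPart-odd {m} om = subst (λ x → v₂ x ≡ 0 × oddPart x ≡ m) (*-identityˡ m) (v₂-oddPart-2^s*m 0 om)

v₂-oddPart-injective : ∀ {p q} → 1 ≤ p → 1 ≤ q → v₂ p ≡ v₂ q → oddPart p ≡ oddPart q → p ≡ q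
v₂-oddPart-injective {p} {q} p≥1 q≥1 v≡ o≡ = begin
  p                      ≡⟨ 2^v₂*oddPart p≥1 ⟨
  2 ^ v₂ p * oddPart p   ≡⟨ cong₂ (λ s m → 2 ^ s * m) v≡ o≡ ⟩
  2 ^ v₂ q * oddPart q   ≡⟨ 2^v₂*oddPart q≥1 ⟩
  q                      ∎
  where open ≡-Reasoning

-- Binary expansions

binaryValue : List ℕ → ℕ
binaryValue S = sum (map (2 ^_) S)

halve : List ℕ → List ℕ
halve [] = []
halve (zero ∷ S) = halve S
halve (suc s ∷ S) = s ∷ halve S

∈-halve⁺ : ∀ {t} S → suc t ∈ S → t ∈ halve S
∈-halve⁺ (zero ∷ S) (there t∈S) = ∈-halve⁺ S t∈S
∈-halve⁺ (suc s ∷ S) (here refl) = here refl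
∈-halve⁺ (suc s ∷ S) (there t∈S) = there (∈-halve⁺ S t∈S)

∈-halve⁻ : ∀ {t} S → t ∈ halve S → suc t ∈ S
∈-halve⁻ (zero ∷ S) t∈ = there (∈-halve⁻ S t∈)
∈-halve⁻ (suc s ∷ S) (here refl) = here refl
∈-halve⁻ (suc s ∷ S) (there t∈) = there (∈-halve⁻ S t∈)

halve-unique : ∀ {S} → Unique S → Unique (halve S)
halve-unique {[]} [] = []
halve-unique {zero ∷ S} (_ ∷ u) = halve-unique u
halve-unique {suc s ∷ S} (s∉S ∷ u) =
  All.tabulate (λ t∈ s≡t → All.lookup s∉S (∈-halve⁻ S t∈) (cong suc s≡t)) ∷ halve-unique u

data LowestBit (S : List ℕ) : Set where
  bit1 : 0 ∈ S → binaryValue S ≡ suc (2 * binaryValue (halve S)) → LowestBit S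
  bit0 : 0 ∉ S → binaryValue S ≡ 2 * binaryValue (halve S) → LowestBit S

lowestBit : ∀ {S} → Unique S → LowestBit S
lowestBit {[]} [] = bit0 (λ ()) refl
lowestBit {zero ∷ S} (0∉S ∷ u) with lowestBit u
... | bit1 0∈S _ = contradiction refl (All.lookup 0∉S 0∈S)
... | bit0 _ eq = bit1 (here refl) (cong suc eq)
lowestBit {suc s ∷ S} (_ ∷ u) with lowestBit u
... | bit1 0∈S eq = bit1 (there 0∈S) (begin
  2 * 2 ^ s + binaryValue S             ≡⟨ cong (_+_ (2 * 2 ^ s)) eq ⟩
  2 * 2 ^ s + suc (2 * h)               ≡⟨ +-suc (2 * 2 ^ s) (2 * h) ⟩
  suc (2 * 2 ^ s + 2 * h)               ≡⟨ cong suc (*-distribˡ-+ 2 (2 ^ s) h) ⟨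
  suc (2 * (2 ^ s + h))                 ∎)
  where open ≡-Reasoning; h = binaryValue (halve S)
... | bit0 0∉S eq = bit0 (λ { (there 0∈S) → 0∉S 0∈S }) (begin
  2 * 2 ^ s + binaryValue S             ≡⟨ cong (_+_ (2 * 2 ^ s)) eq ⟩
  2 * 2 ^ s + 2 * binaryValue (halve S) ≡⟨ *-distribˡ-+ 2 (2 ^ s) _ ⟨
  2 * (2 ^ s + binaryValue (halve S))   ∎)
  where open ≡-Reasoning

lowestBit-cong : ∀ {S T} → Unique S → Unique T → binaryValue S ≡ binaryValue T →
                 (0 ∈ S → 0 ∈ T) × binaryValue (halve S) ≡ binaryValue (halve T)
lowestBit-cong {S} {T} uS uT eq with lowestBit uS | lowestBit uT
... | bit1 _ eS | bit1 0∈T eT = (λ _ → 0∈T) , *-cancelˡ-≡ _ _ 2 (suc-injective (trans (sym eS) (trans eq eT)))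
... | bit0 0∉S eS | bit0 _ eT = (λ 0∈S → contradiction 0∈S 0∉S) , *-cancelˡ-≡ _ _ 2 (trans (sym eS) (trans eq eT))
... | bit1 _ eS | bit0 _ eT =
  contradiction (trans (sym eT) (trans (sym eq) eS)) (even≢odd (binaryValue (halve T)) (binaryValue (halve S)))
... | bit0 _ eS | bit1 _ eT =
  contradiction (trans (sym eS) (trans eq eT)) (even≢odd (binaryValue (halve S)) (binaryValue (halve T)))

-- Induction on the element: equal values have the same lowest bit and equal halves.
binaryValue-≡⇒⊆ : ∀ {S T} → Unique S → Unique T → binaryValue S ≡ binaryValue T → S ⊆ T
binaryValue-≡⇒⊆ uS uT eq {zero} 0∈S = proj₁ (lowestBit-cong uS uT eq) 0∈S
binaryValue-≡⇒⊆ {S} {T} uS uT eq {suc t} s∈S =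
  ∈-halve⁻ T (binaryValue-≡⇒⊆ (halve-unique uS) (halve-unique uT) (proj₂ (lowestBit-cong uS uT eq))
                              (∈-halve⁺ S s∈S))

splitPart : ℕ → List ℕ
splitPart p = replicate (2 ^ v₂ p) (oddPart p)

splitParts : List ℕ → List ℕ
splitParts = concatMap splitPart

sum-splitPart : ∀ {p} → 1 ≤ p → sum (splitPart p) ≡ p
sum-splitPart {p} p≥1 = trans (sum-replicate (2 ^ v₂ p) (oddPart p)) (2^v₂*oddPart p≥1)

sum-splitParts : ∀ {μ} → All (1 ≤_) μ → sum (splitParts μ) ≡ sum μ
sum-splitParts [] = refl
sum-splitParts {p ∷ μ} (p≥1 ∷ μ≥1) =
  trans (sum-++ (splitPart p) (splitParts μ)) (cong₂ _+_ (sum-splitPart p≥1) (sum-splitParts μ≥1))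

splitParts-odd : ∀ {μ} → All (1 ≤_) μ → All Odd (splitParts μ)
splitParts-odd μ≥1 = All.concat⁺ (All.map⁺ (All.map (λ p≥1 → All.replicate⁺ _ (oddPart-odd p≥1)) μ≥1))

∈-splitPart⁻ : ∀ {m p} → m ∈ splitPart p → oddPart p ≡ m
∈-splitPart⁻ {p = p} m∈ = All.lookup (All.replicate⁺ {P = oddPart p ≡_} (2 ^ v₂ p) refl) m∈

oddPart∈splitPart : ∀ p → oddPart p ∈ splitPart p
oddPart∈splitPart p with 2 ^ v₂ p | m^n>0 2 (v₂ p)
... | suc _ | _ = here refl

∈-splitParts⁻ : ∀ {m} μ → m ∈ splitParts μ → ∃[ p ] p ∈ μ × oddPart p ≡ m
∈-splitParts⁻ μ m∈ with p , p∈μ , m∈p ← find (∈-concatMap⁻ splitPart {xs = μ} m∈) =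
  p , p∈μ , ∈-splitPart⁻ {p = p} m∈p

∈-splitParts⁺ : ∀ {p μ} → p ∈ μ → oddPart p ∈ splitParts μ
∈-splitParts⁺ {p} p∈μ = ∈-concatMap⁺ splitPart (lose p∈μ (oddPart∈splitPart p))

splitParts-↭ : ∀ {μ ν} → μ ↭ ν → splitParts μ ↭ splitParts ν
splitParts-↭ μ↭ν = Bag.∼bag⇒↭ (Bag.concat-cong (Bag.map-cong (λ _ → refl) (Bag.↭⇒∼bag μ↭ν)))

splitPart-odd : ∀ {m} → Odd m → splitPart m ≡ [ m ]
splitPart-odd om with v≡0 , o≡m ← v₂-oddPart-odd om = cong₂ replicate (cong (2 ^_) v≡0) o≡m

splitPart-double : ∀ {p} → 1 ≤ p → splitPart (2 * p) ≡ splitPart p ++ splitPart p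
splitPart-double {p} p≥1 = begin
  splitPart (2 * p)                  ≡⟨ cong splitPart 2p≡ ⟩
  splitPart (2 ^ suc v * o)          ≡⟨ cong₂ replicate (cong (2 ^_) v≡) o≡ ⟩
  replicate (2 ^ v + (2 ^ v + 0)) o  ≡⟨ cong (λ k → replicate (2 ^ v + k) o) (+-identityʳ (2 ^ v)) ⟩
  replicate (2 ^ v + 2 ^ v) o        ≡⟨ replicate-+ (2 ^ v) (2 ^ v) o ⟩
  splitPart p ++ splitPart p         ∎
  where
  open ≡-Reasoning
  v = v₂ p
  o = oddPart p
  2p≡ : 2 * p ≡ 2 ^ suc v * o
  2p≡ = trans (cong (2 *_) (sym (2^v₂*oddPart p≥1))) (sym (2^[1+s]*m v o))
  v≡ = proj₁ (v₂-oddPart-2^s*m (suc v) (oddPart-odd p≥1))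
  o≡ = proj₂ (v₂-oddPart-2^s*m (suc v) (oddPart-odd p≥1))

exponents : ℕ → List ℕ → List ℕ
exponents m μ = map v₂ (filter (λ p → oddPart p ≟ m) μ)

∈-exponents⁺ : ∀ {p μ} → p ∈ μ → v₂ p ∈ exponents (oddPart p) μ
∈-exponents⁺ p∈μ = ∈-map⁺ v₂ (∈-filter⁺ (λ p → oddPart p ≟ _) p∈μ refl)

∈-exponents⁻ : ∀ {s m} μ → s ∈ exponents m μ → ∃[ q ] q ∈ μ × v₂ q ≡ s × oddPart q ≡ m
∈-exponents⁻ μ s∈
  with q , q∈ , refl ← ∈-map⁻ v₂ s∈
  with q∈μ , oq≡m ← ∈-filter⁻ (λ p → oddPart p ≟ _) {xs = μ} q∈
  = q , q∈μ , refl , oq≡m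

exponents-unique : ∀ m {μ} → All (1 ≤_) μ → Unique μ → Unique (exponents m μ)
exponents-unique m {μ} μ≥1 u = map⁺-injectiveOn v₂
  (λ (p≥1 , op≡m) (q≥1 , oq≡m) v≡ → v₂-oddPart-injective p≥1 q≥1 v≡ (trans op≡m (sym oq≡m)))
  (All.zip (All.filter⁺ (λ p → oddPart p ≟ m) μ≥1 , All.all-filter (λ p → oddPart p ≟ m) μ))
  (Unique.filter⁺ (λ p → oddPart p ≟ m) u)

multiplicity-splitParts : ∀ m {μ} → All (1 ≤_) μ →
                          length (filter (_≟ m) (splitParts μ)) ≡ binaryValue (exponents m μ)
multiplicity-splitParts m [] = refl
multiplicity-splitParts m {p ∷ μ} (_ ∷ μ≥1) = begin
  length (filter (_≟ m) (splitPart p ++ splitParts μ))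
    ≡⟨ length-filter-++ (_≟ m) (splitPart p) ⟩
  length (filter (_≟ m) (splitPart p)) + length (filter (_≟ m) (splitParts μ))
    ≡⟨ cong (_+_ (length (filter (_≟ m) (splitPart p)))) (multiplicity-splitParts m μ≥1) ⟩
  length (filter (_≟ m) (splitPart p)) + rest
    ≡⟨ firstPart (oddPart p ≟ m) ⟩
  binaryValue (exponents m (p ∷ μ)) ∎
  where
  open ≡-Reasoning
  rest = binaryValue (exponents m μ)
  firstPart : Dec (oddPart p ≡ m) → length (filter (_≟ m) (splitPart p)) + rest ≡ binaryValue (exponents m (p ∷ μ))
  firstPart (yes op≡m) = begin
    length (filter (_≟ m) (splitPart p)) + rest
      ≡⟨ cong (λ xs → length xs + rest) (filter-all (_≟ m) (All.replicate⁺ (2 ^ v₂ p) op≡m)) ⟩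
    length (splitPart p) + rest
      ≡⟨ cong (_+ rest) (length-replicate (2 ^ v₂ p)) ⟩
    2 ^ v₂ p + rest
      ≡⟨ cong (binaryValue ∘ map v₂) (filter-accept (λ q → oddPart q ≟ m) {x = p} {xs = μ} op≡m) ⟨
    binaryValue (exponents m (p ∷ μ)) ∎
  firstPart (no op≢m) = begin
    length (filter (_≟ m) (splitPart p)) + rest
      ≡⟨ cong (λ xs → length xs + rest) (filter-none (_≟ m) (All.replicate⁺ (2 ^ v₂ p) op≢m)) ⟩
    rest
      ≡⟨ cong (binaryValue ∘ map v₂) (filter-reject (λ q → oddPart q ≟ m) {x = p} {xs = μ} op≢m) ⟨
    binaryValue (exponents m (p ∷ μ)) ∎

binaryValue-exponents-cong : ∀ m {μ ν} → All (1 ≤_) μ → All (1 ≤_) ν → splitParts μ ↭ splitParts ν →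
                             binaryValue (exponents m μ) ≡ binaryValue (exponents m ν)
binaryValue-exponents-cong m {μ} {ν} μ≥1 ν≥1 split↭ = begin
  binaryValue (exponents m μ)              ≡⟨ multiplicity-splitParts m μ≥1 ⟨
  length (filter (_≟ m) (splitParts μ))    ≡⟨ ↭-length (filter-↭ (_≟ m) split↭) ⟩
  length (filter (_≟ m) (splitParts ν))    ≡⟨ multiplicity-splitParts m ν≥1 ⟩
  binaryValue (exponents m ν)              ∎
  where open ≡-Reasoning

splitParts-↭⇒⊆ : ∀ {μ ν} → All (1 ≤_) μ → All (1 ≤_) ν → Unique μ → Unique ν →
                 splitParts μ ↭ splitParts ν → μ ⊆ ν
splitParts-↭⇒⊆ {μ} {ν} μ≥1 ν≥1 uμ uν split↭ {p} p∈μ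
  with q , q∈ν , vq≡vp , oq≡op ← ∈-exponents⁻ ν
         (binaryValue-≡⇒⊆ (exponents-unique _ μ≥1 uμ) (exponents-unique _ ν≥1 uν)
           (binaryValue-exponents-cong (oddPart p) μ≥1 ν≥1 split↭) (∈-exponents⁺ p∈μ))
  = subst (_∈ ν) (v₂-oddPart-injective (All.lookup ν≥1 q∈ν) (All.lookup μ≥1 p∈μ) vq≡vp oq≡op) q∈ν

-- Each merge removes a part of μ, so fuel exceeding length μ never runs out (insertMerging-unique).
insertMerging : ℕ → ℕ → List ℕ → List ℕ
insertMerging zero p μ = p ∷ μ
insertMerging (suc fuel) p μ with p ∈? μ
... | yes p∈μ = insertMerging fuel (2 * p) (μ ─ p∈μ)
... | no _ = p ∷ μ

insertMerging-positive : ∀ fuel {p μ} → 1 ≤ p → All (1 ≤_) μ → All (1 ≤_) (insertMerging fuel p μ)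
insertMerging-positive zero p≥1 μ≥1 = p≥1 ∷ μ≥1
insertMerging-positive (suc fuel) {p} {μ} p≥1 μ≥1 with p ∈? μ
... | yes p∈μ = insertMerging-positive fuel (≤-trans p≥1 (m≤n*m p 2)) (All.─⁺ p∈μ μ≥1)
... | no _ = p≥1 ∷ μ≥1

insertMerging-unique : ∀ fuel {p μ} → length μ < fuel → Unique μ → Unique (insertMerging fuel p μ)
insertMerging-unique (suc fuel) {p} {μ} |μ|<fuel u with p ∈? μ
... | no p∉μ = All.¬Any⇒All¬ μ p∉μ ∷ u
... | yes p∈μ with _ ∷ u′ ← Unique-resp-↭ (─-↭ p∈μ) u =
  insertMerging-unique fuel (≤-pred (subst (_< suc fuel) (↭-length (─-↭ p∈μ)) |μ|<fuel)) u′

insertMerging-splitParts : ∀ fuel {p μ} → 1 ≤ p → All (1 ≤_) μ →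
                           splitParts (insertMerging fuel p μ) ↭ splitPart p ++ splitParts μ
insertMerging-splitParts zero _ _ = ↭-refl
insertMerging-splitParts (suc fuel) {p} {μ} p≥1 μ≥1 with p ∈? μ
... | no _ = ↭-refl
... | yes p∈μ = begin
  splitParts (insertMerging fuel (2 * p) (μ ─ p∈μ))
    ↭⟨ insertMerging-splitParts fuel 2p≥1 (All.─⁺ p∈μ μ≥1) ⟩
  splitPart (2 * p) ++ splitParts (μ ─ p∈μ)
    ≡⟨ cong (_++ splitParts (μ ─ p∈μ)) (splitPart-double p≥1) ⟩
  (splitPart p ++ splitPart p) ++ splitParts (μ ─ p∈μ)
    ≡⟨ ++-assoc (splitPart p) (splitPart p) _ ⟩
  splitPart p ++ splitParts (p ∷ (μ ─ p∈μ))
    ↭⟨ ++⁺ˡ (splitPart p) (splitParts-↭ (↭-sym (─-↭ p∈μ))) ⟩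
  splitPart p ++ splitParts μ ∎
  where
  open PermutationReasoning
  2p≥1 = ≤-trans p≥1 (m≤n*m p 2)

mergeParts : List ℕ → List ℕ
mergeParts [] = []
mergeParts (p ∷ l) = insertMerging (suc (length (mergeParts l))) p (mergeParts l)

mergeParts-positive : ∀ {l} → All (1 ≤_) l → All (1 ≤_) (mergeParts l)
mergeParts-positive [] = []
mergeParts-positive (p≥1 ∷ l≥1) = insertMerging-positive _ p≥1 (mergeParts-positive l≥1)

mergeParts-unique : ∀ l → Unique (mergeParts l)
mergeParts-unique [] = []
mergeParts-unique (p ∷ l) = insertMerging-unique _ ≤-refl (mergeParts-unique l)

splitParts-mergeParts : ∀ {l} → All (1 ≤_) l → All Odd l → splitParts (mergeParts l) ↭ l
splitParts-mergeParts [] [] = ↭-refl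
splitParts-mergeParts {p ∷ l} (p≥1 ∷ l≥1) (op ∷ ol) = begin
  splitParts (mergeParts (p ∷ l))
    ↭⟨ insertMerging-splitParts (suc (length (mergeParts l))) p≥1 (mergeParts-positive l≥1) ⟩
  splitPart p ++ splitParts (mergeParts l)
    ≡⟨ cong (_++ splitParts (mergeParts l)) (splitPart-odd op) ⟩
  p ∷ splitParts (mergeParts l)
    <⟨ splitParts-mergeParts l≥1 ol ⟩
  p ∷ l ∎
  where open PermutationReasoning

-- Glaisher's bijection

glaisher : List ℕ → List ℕ
glaisher μ = sort (splitParts μ)

glaisherInverse : List ℕ → List ℕ
glaisherInverse l = sort (mergeParts l)

glaisher-isOddPartition : ∀ {n μ} → IsDistinctPartition n μ → IsOddPartition n (glaisher μ)
glaisher-isOddPartition {μ = μ} ((μ≥1 , _ , Σμ≡n) , _) =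
  (All.map odd⇒≥1 allOdd , sort-↗ (splitParts μ) , Σ≡n) , allOdd
  where
  Σ≡n = trans (sum-↭ (sort-↭ (splitParts μ))) (trans (sum-splitParts μ≥1) Σμ≡n)
  allOdd : All Odd (glaisher μ)
  allOdd = All-resp-↭ (↭-sym (sort-↭ (splitParts μ))) (splitParts-odd μ≥1)

glaisherInverse-isDistinctPartition : ∀ {n l} → IsOddPartition n l → IsDistinctPartition n (glaisherInverse l)
glaisherInverse-isDistinctPartition {l = l} ((l≥1 , _ , Σl≡n) , l-odd) =
  (All-resp-↭ sort↭ (mergeParts-positive l≥1) , sort-↗ (mergeParts l) , Σ≡n)
  , Unique-resp-↭ sort↭ (mergeParts-unique l)
  where
  sort↭ = ↭-sym (sort-↭ (mergeParts l))
  Σ≡n : sum (glaisherInverse l) ≡ _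
  Σ≡n = begin
    sum (glaisherInverse l)           ≡⟨ sum-↭ (sort-↭ (mergeParts l)) ⟩
    sum (mergeParts l)                ≡⟨ sum-splitParts (mergeParts-positive l≥1) ⟨
    sum (splitParts (mergeParts l))   ≡⟨ sum-↭ (splitParts-mergeParts l≥1 l-odd) ⟩
    sum l                             ≡⟨ Σl≡n ⟩
    _                                 ∎
    where open ≡-Reasoning

glaisher-glaisherInverse : ∀ {n l} → IsOddPartition n l → glaisher (glaisherInverse l) ≡ l
glaisher-glaisherInverse {l = l} ((l≥1 , l↘ , _) , l-odd) = sorted-↭⇒≡ (sort-↗ _) l↘ (begin
  sort (splitParts (glaisherInverse l))   ↭⟨ sort-↭ _ ⟩
  splitParts (sort (mergeParts l))        ↭⟨ splitParts-↭ (sort-↭ (mergeParts l)) ⟩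
  splitParts (mergeParts l)               ↭⟨ splitParts-mergeParts l≥1 l-odd ⟩
  l                                       ∎)
  where open PermutationReasoning

glaisher-injective : ∀ {n n′ μ ν} → IsDistinctPartition n μ → IsDistinctPartition n′ ν →
                     glaisher μ ≡ glaisher ν → μ ≡ ν
glaisher-injective {μ = μ} {ν} ((μ≥1 , μ↘ , _) , uμ) ((ν≥1 , ν↘ , _) , uν) gμ≡gν =
  sorted-↭⇒≡ μ↘ ν↘ (unique-⊆⊇⇒↭ uμ uν (splitParts-↭⇒⊆ μ≥1 ν≥1 uμ uν split↭)
                                      (splitParts-↭⇒⊆ ν≥1 μ≥1 uν uμ (↭-sym split↭)))
  where
  split↭ : splitParts μ ↭ splitParts ν
  split↭ = ↭-trans (↭-sym (sort-↭ (splitParts μ))) (↭-trans (↭-reflexive gμ≡gν) (sort-↭ (splitParts ν)))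

∈-glaisher⁺ : ∀ {p μ} → p ∈ μ → oddPart p ∈ glaisher μ
∈-glaisher⁺ {μ = μ} p∈μ = ∈-resp-↭ (↭-sym (sort-↭ (splitParts μ))) (∈-splitParts⁺ p∈μ)

∈-glaisher⁻ : ∀ {m μ} → m ∈ glaisher μ → ∃[ p ] p ∈ μ × oddPart p ≡ m
∈-glaisher⁻ {μ = μ} m∈ = ∈-splitParts⁻ μ (∈-resp-↭ (sort-↭ (splitParts μ)) m∈)

glaisher-↭ : ∀ {n Ds Os} → Enumerates (IsDistinctPartition n) Ds → Enumerates (IsOddPartition n) Os →
             map glaisher Ds ↭ Os
glaisher-↭ {n} {Ds} {Os} (uDs , eDs) (uOs , eOs) = unique-⊆⊇⇒↭
  (map⁺-injectiveOn glaisher glaisher-injective (enumerates⇒All (uDs , eDs)) uDs) uOs images⊆ ⊆images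
  where
  images⊆ : map glaisher Ds ⊆ Os
  images⊆ l∈ with μ , μ∈Ds , refl ← ∈-map⁻ glaisher l∈ =
    proj₂ (eOs _) (glaisher-isOddPartition (proj₁ (eDs μ) μ∈Ds))
  ⊆images : Os ⊆ map glaisher Ds
  ⊆images {l} l∈Os = subst (_∈ map glaisher Ds) (glaisher-glaisherInverse ol)
    (∈-map⁺ glaisher (proj₂ (eDs _) (glaisherInverse-isDistinctPartition ol)))
    where ol = proj₁ (eOs l) l∈Os

-- The paper's condition on an overlined part 2^s m, that μ has a part 2^t m with t < s.
Overlinable : List ℕ → ℕ → Set
Overlinable μ p = Any (λ q → q < p × oddPart q ≡ oddPart p) μ

overlinable? : ∀ μ → Decidable (Overlinable μ)
overlinable? μ p = any? (λ q → q <? p ×-dec oddPart q ≟ oddPart p) μ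

overlinableParts nonOverlinableParts : List ℕ → List ℕ
overlinableParts μ = filter (overlinable? μ) μ
nonOverlinableParts μ = filter (¬? ∘ overlinable? μ) μ

nonOverlinable-injective : ∀ {μ p q} → p ∈ μ → q ∈ μ → ¬ Overlinable μ p → ¬ Overlinable μ q →
                           oddPart p ≡ oddPart q → p ≡ q
nonOverlinable-injective {p = p} {q} p∈μ q∈μ ¬op ¬oq op≡oq with <-cmp p q
... | tri< p<q _ _ = contradiction (lose p∈μ (p<q , op≡oq)) ¬oq
... | tri≈ _ p≡q _ = p≡q
... | tri> _ _ q<p = contradiction (lose q∈μ (q<p , sym op≡oq)) ¬op

smallestOfOddClass : ∀ {μ p} → p ∈ μ → ∃[ q ] q ∈ nonOverlinableParts μ × oddPart q ≡ oddPart p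
smallestOfOddClass {μ} {p} = <-rec HasSmallest step p
  where
  HasSmallest : ℕ → Set
  HasSmallest p = p ∈ μ → ∃[ q ] q ∈ nonOverlinableParts μ × oddPart q ≡ oddPart p
  step : ∀ p → (∀ {r} → r < p → HasSmallest r) → HasSmallest p
  step p rec p∈μ with overlinable? μ p
  ... | no ¬op = p , ∈-filter⁺ (¬? ∘ overlinable? μ) p∈μ ¬op , refl
  ... | yes op
    with r , r∈μ , r<p , or≡op ← find op
    with q , q∈ , oq≡or ← rec r<p r∈μ
    = q , q∈ , trans oq≡or or≡op

numDifferentParts-glaisher : ∀ {μ} → Unique μ → numDifferentParts (glaisher μ) ≡ length (nonOverlinableParts μ)
numDifferentParts-glaisher {μ} uμ = begin
  numDifferentParts (glaisher μ)
    ≡⟨ unique⊆⊇⇒length-deduplicate oddClasses-unique oddClasses⊆ ⊆oddClasses ⟩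
  length (map oddPart (nonOverlinableParts μ))
    ≡⟨ length-map oddPart (nonOverlinableParts μ) ⟩
  length (nonOverlinableParts μ) ∎
  where
  open ≡-Reasoning
  oddClasses-unique : Unique (map oddPart (nonOverlinableParts μ))
  oddClasses-unique = map⁺-injectiveOn oddPart
    (λ (p∈μ , ¬op) (q∈μ , ¬oq) → nonOverlinable-injective p∈μ q∈μ ¬op ¬oq)
    (All.tabulate (∈-filter⁻ (¬? ∘ overlinable? μ) {xs = μ}))
    (Unique.filter⁺ (¬? ∘ overlinable? μ) uμ)
  oddClasses⊆ : map oddPart (nonOverlinableParts μ) ⊆ glaisher μ
  oddClasses⊆ m∈ with q , q∈ , refl ← ∈-map⁻ oddPart m∈ =
    ∈-glaisher⁺ (proj₁ (∈-filter⁻ (¬? ∘ overlinable? μ) {xs = μ} q∈))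
  ⊆oddClasses : glaisher μ ⊆ map oddPart (nonOverlinableParts μ)
  ⊆oddClasses m∈
    with p , p∈μ , refl ← ∈-glaisher⁻ {μ = μ} m∈
    with q , q∈ , oq≡op ← smallestOfOddClass p∈μ
    = subst (_∈ map oddPart (nonOverlinableParts μ)) oq≡op (∈-map⁺ oddPart q∈)

inDbar⇒overlinable : ∀ {n μ p} → InDbar n (μ , p) → p ∈ overlinableParts μ
inDbar⇒overlinable {μ = μ} {p} (_ , p∈μ , s , m , t , _ , om@(k , refl) , refl , t<s , q∈μ) =
  ∈-filter⁺ (overlinable? μ) p∈μ (lose q∈μ (q<p , trans oq≡m (sym op≡m)))
  where
  q<p : 2 ^ t * m < 2 ^ s * m
  q<p = *-monoˡ-< m (^-monoʳ-< 2 (s≤s (s≤s z≤n)) t<s)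
  oq≡m = proj₂ (v₂-oddPart-2^s*m t om)
  op≡m = proj₂ (v₂-oddPart-2^s*m s om)

overlinable⇒inDbar : ∀ {n μ p} → IsDistinctPartition n μ → p ∈ overlinableParts μ → InDbar n (μ , p)
overlinable⇒inDbar {μ = μ} {p} dμ@((μ≥1 , _) , _) p∈
  with p∈μ , op ← ∈-filter⁻ (overlinable? μ) {xs = μ} p∈
  with q , q∈μ , q<p , oq≡op ← find op
  = dμ , p∈μ , v₂ p , oddPart p , v₂ q
  , ≤-trans (s≤s z≤n) vq<vp , oddPart-odd p≥1 , sym (2^v₂*oddPart p≥1) , vq<vp , q′∈μ
  where
  p≥1 = All.lookup μ≥1 p∈μ
  q≥1 = All.lookup μ≥1 q∈μ
  q≡ : 2 ^ v₂ q * oddPart p ≡ q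
  q≡ = trans (cong (2 ^ v₂ q *_) (sym oq≡op)) (2^v₂*oddPart q≥1)
  q′∈μ : 2 ^ v₂ q * oddPart p ∈ μ
  q′∈μ = subst (_∈ μ) (sym q≡) q∈μ
  vq<vp : v₂ q < v₂ p
  vq<vp = ≰⇒> λ vp≤vq → <⇒≱ q<p
    (subst₂ _≤_ (2^v₂*oddPart p≥1) q≡ (*-monoˡ-≤ (oddPart p) (^-monoʳ-≤ 2 vp≤vq)))

overlinings : List ℕ → List (List ℕ × ℕ)
overlinings μ = map (μ ,_) (overlinableParts μ)

overpartitions : List (List ℕ) → List (List ℕ × ℕ)
overpartitions = concatMap overlinings

length-overpartitions : ∀ Ds → length (overpartitions Ds) ≡ sum (map (length ∘ overlinableParts) Ds)
length-overpartitions [] = refl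
length-overpartitions (μ ∷ Ds) = trans (length-++ (overlinings μ))
  (cong₂ _+_ (length-map (μ ,_) (overlinableParts μ)) (length-overpartitions Ds))

∈-overpartitions⁺ : ∀ {μ p Ds} → μ ∈ Ds → p ∈ overlinableParts μ → (μ , p) ∈ overpartitions Ds
∈-overpartitions⁺ {μ} μ∈Ds p∈ = ∈-concatMap⁺ overlinings (lose μ∈Ds (∈-map⁺ (μ ,_) p∈))

∈-overpartitions⁻ : ∀ {μ p} Ds → (μ , p) ∈ overpartitions Ds → μ ∈ Ds × p ∈ overlinableParts μ
∈-overpartitions⁻ Ds x∈
  with ν , ν∈Ds , x∈ν ← find (∈-concatMap⁻ overlinings {xs = Ds} x∈)
  with q , q∈ , refl ← ∈-map⁻ (ν ,_) x∈ν
  = ν∈Ds , q∈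

overpartitions-unique : ∀ {Ds} → Unique Ds → All Unique Ds → Unique (overpartitions Ds)
overpartitions-unique uDs uμs = Unique.concat⁺
  (All.map⁺ (All.map (λ {μ} uμ → Unique.map⁺ (cong proj₂) (Unique.filter⁺ (overlinable? μ) uμ)) uμs))
  (AllPairs.map⁺ (AllPairs.map disjoint uDs))
  where
  disjoint : ∀ {μ ν} → μ ≢ ν → ∀ {x} → ¬ (x ∈ overlinings μ × x ∈ overlinings ν)
  disjoint μ≢ν (x∈μ , x∈ν) with _ , _ , refl ← ∈-map⁻ _ x∈μ with _ , _ , eq ← ∈-map⁻ _ x∈ν = μ≢ν (cong proj₁ eq)

sum-numDifferentParts : ∀ {n Ds Os} → Enumerates (IsDistinctPartition n) Ds → Enumerates (IsOddPartition n) Os →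
                        sum (map numDifferentParts Os) ≡ sum (map (length ∘ nonOverlinableParts) Ds)
sum-numDifferentParts {Ds = Ds} {Os} eDs eOs = begin
  sum (map numDifferentParts Os)
    ≡⟨ sum-↭ (map⁺ numDifferentParts (glaisher-↭ eDs eOs)) ⟨
  sum (map numDifferentParts (map glaisher Ds))
    ≡⟨ cong sum (map-∘ Ds) ⟨
  sum (map (numDifferentParts ∘ glaisher) Ds)
    ≡⟨ cong sum (map-cong-local (All.map (numDifferentParts-glaisher ∘ proj₂) (enumerates⇒All eDs))) ⟩
  sum (map (length ∘ nonOverlinableParts) Ds) ∎
  where open ≡-Reasoning

length-Dbar : ∀ {n Ds Dbar} → Enumerates (IsDistinctPartition n) Ds → Enumerates (InDbar n) Dbar →
              length Dbar ≡ sum (map (length ∘ overlinableParts) Ds)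
length-Dbar {n} {Ds} {Dbar} eDs@(uDs , isDs) (uDbar , isDbar) = trans
  (↭-length (unique-⊆⊇⇒↭ uDbar (overpartitions-unique uDs (All.map proj₂ (enumerates⇒All eDs))) Dbar⊆ ⊆Dbar))
  (length-overpartitions Ds)
  where
  Dbar⊆ : Dbar ⊆ overpartitions Ds
  Dbar⊆ {μ , p} x∈ = ∈-overpartitions⁺ (proj₂ (isDs μ) (proj₁ d)) (inDbar⇒overlinable d)
    where d = proj₁ (isDbar _) x∈
  ⊆Dbar : overpartitions Ds ⊆ Dbar
  ⊆Dbar {μ , p} x∈ with μ∈Ds , p∈ ← ∈-overpartitions⁻ Ds x∈ =
    proj₂ (isDbar _) (overlinable⇒inDbar (proj₁ (isDs μ) μ∈Ds) p∈)

sum-length-split : ∀ Ds → sum (map length Ds) ≡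
                   sum (map (length ∘ nonOverlinableParts) Ds) + sum (map (length ∘ overlinableParts) Ds)
sum-length-split Ds = trans (cong sum (map-cong (λ μ → length-filter-complement (overlinable? μ) μ) Ds))
  (sum-map-+ (length ∘ nonOverlinableParts) (length ∘ overlinableParts) Ds)

mainTheorem4 : (n : ℕ) → 1 ≤ n →
    (Ds : List (List ℕ)) → Enumerates (IsDistinctPartition n) Ds →
    (Os : List (List ℕ)) → Enumerates (IsOddPartition n) Os →
    (Dbar : List (List ℕ × ℕ)) → Enumerates (InDbar n) Dbar →
    (+ sum (map length Ds)) - (+ sum (map numDifferentParts Os)) ≡ + length Dbar
mainTheorem4 n _ Ds eDs Os eOs Dbar eDbar = begin
  + sum (map length Ds) - + sum (map numDifferentParts Os)
    ≡⟨ cong₂ (λ a b → + a - + b) (sum-length-split Ds) (sum-numDifferentParts eDs eOs) ⟩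
  + (minimal + overlinable) - + minimal
    ≡⟨ +[m+n]-+m≡+n minimal overlinable ⟩
  + overlinable
    ≡⟨ cong +_ (length-Dbar eDs eDbar) ⟨
  + length Dbar ∎
  where
  open ≡-Reasoning
  minimal = sum (map (length ∘ nonOverlinableParts) Ds)
  overlinable = sum (map (length ∘ overlinableParts) Ds)
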